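{- Let $m\ge 2$ and let $u,v\in\mathcal{A}_m$ with $u<v$. Then $\delta(u)<\delta(v)$. If moreover $u$ and $v$ have the same first letter, then $\varepsilon(u)<\varepsilon(v)$.
   Context: The Thue-Morse substitution is $\theta(0)=01$, $\theta(1)=10$, and the Thue-Morse sequence is its fixed point $x=0110100110010110\dots$. For $m\ge1$, $\mathcal{A}_m$ denotes the set of subwords of $x$ of length $2^m+1$, ordered lexicographically (with $0<1$). For $u\in\mathcal{A}_m$ (so $\theta(u)$ has length $2^{m+1}+2$), $\delta(u)$ is the prefix of length $2^{m+1}+1$ of $\theta(u)$ and $\varepsilon(u)$ is the suffix of length $2^{m+1}+1$ of $\theta(u)$; both lie in $\mathcal{A}_{m+1}$. -}

module Defs where

open import Data.Bool using (Bool; true; false; not)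
open import Data.Nat using (ℕ; zero; suc; _+_; _^_)
open import Data.List using (List; []; _∷_; concatMap; length; take; drop; map; upTo)
open import Data.Product using (∃; _×_; _,_)
open import Relation.Binary.PropositionalEquality using (_≡_)

-- Letters: false = 0, true = 1.  Words are lists of letters.

θ₁ : Bool → List Bool
θ₁ b = b ∷ not b ∷ []

θ : List Bool → List Bool
θ = concatMap θ₁

θ-iter : ℕ → List Bool
θ-iter zero    = false ∷ []
θ-iter (suc n) = θ (θ-iter n)

nth : List Bool → ℕ → Bool
nth []       _       = false
nth (b ∷ _)  zero    = b
nth (_ ∷ bs) (suc n) = nth bs n

-- The Thue-Morse sequence x = lim θⁿ(0); x_i is the i-th letter of θ^(i+1)(0),
-- which has length 2^(i+1) > i.
x : ℕ → Bool
x i = nth (θ-iter (suc i)) i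

factor : ℕ → ℕ → List Bool
factor i L = map (λ k → x (i + k)) (upTo L)

IsFactor : List Bool → Set
IsFactor w = ∃ λ i → w ≡ factor i (length w)

InA : ℕ → List Bool → Set
InA m u = IsFactor u × length u ≡ 2 ^ m + 1

data _<lex_ : List Bool → List Bool → Set where
  here : ∀ {us vs} → (false ∷ us) <lex (true ∷ vs)
  there : ∀ {b us vs} → us <lex vs → (b ∷ us) <lex (b ∷ vs)

δ : ℕ → List Bool → List Bool
δ m u = take (2 ^ suc m + 1) (θ u)

ε : ℕ → List Bool → List Bool
ε m u = drop (length (θ u) Data.Nat.∸ (2 ^ suc m + 1)) (θ u)

module Submission where

-- The substitution θ doubles every letter into a pair b(not b),
-- so it is strictly increasing for the lexicographic order, and the first
-- difference between θ u and θ v (for u < v) is a pair 01 versus 10: it sits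
-- at an even position 2i and position 2i+1 still lies inside θ u.  Hence
-- removing the last letter of θ u and θ v keeps the order, which is the
-- statement for δ.  For ε, every word of 𝒜_m has length 2^m + 1, so θ u has
-- length 2^(m+1) + 2 and ε u is θ u with its first letter removed.  If u = a u′
-- and v = a v′ with u′ < v′, then ε u = (not a) θ u′ and ε v = (not a) θ v′,
-- which compare like θ u′ and θ v′.

open import Defs
open import Data.Nat using (ℕ; _≤_; suc; _+_; _*_; _^_; _∸_; s≤s)
open import Data.Nat.Properties using (+-assoc; +-comm; +-suc; *-distribˡ-+; ≤-reflexive; m+n∸m≡n)
open import Data.List using (List; []; _∷_; take; drop; length)
open import Data.Bool using (Bool)
open import Data.Product using (_×_; _,_)
open import Relation.Binary.PropositionalEquality using (_≡_; refl; cong; sym; trans; module ≡-Reasoning)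

length-θ : (u : List Bool) → length (θ u) ≡ 2 * length u
length-θ []      = refl
length-θ (b ∷ u) = cong suc (trans (cong suc (length-θ u)) (sym (+-suc (length u) (length u + 0))))

θ-mono : ∀ {u v} → u <lex v → θ u <lex θ v
θ-mono here      = here
θ-mono (there p) = there (there (θ-mono p))

-- The first difference of θ u and θ v lies strictly before the last letter
-- of θ u, so truncating both images to all but (at least) that last letter
-- preserves the strict order.
θ-take-mono : ∀ {u v} → u <lex v → ∀ n → length (θ u) ≤ suc n →
  take n (θ u) <lex take n (θ v)
θ-take-mono here                   (suc n)       _                 = here
θ-take-mono here                   0             (s≤s ())
θ-take-mono (there {us = []} ())   _             _
θ-take-mono (there {us = _ ∷ _} p) (suc (suc n)) (s≤s (s≤s θu≤n)) = there (there (θ-take-mono p n θu≤n))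

length-θ-A : (m : ℕ) (u : List Bool) → length u ≡ 2 ^ m + 1 →
  length (θ u) ≡ (2 ^ suc m + 1) + 1
length-θ-A m u |u| = begin
  length (θ u)          ≡⟨ length-θ u ⟩
  2 * length u          ≡⟨ cong (2 *_) |u| ⟩
  2 * (2 ^ m + 1)       ≡⟨ *-distribˡ-+ 2 (2 ^ m) 1 ⟩
  2 ^ suc m + 2         ≡⟨ sym (+-assoc (2 ^ suc m) 1 1) ⟩
  (2 ^ suc m + 1) + 1   ∎
  where open ≡-Reasoning

ε-drop-first : (m : ℕ) (u : List Bool) → length u ≡ 2 ^ m + 1 → ε m u ≡ drop 1 (θ u)
ε-drop-first m u |u| = cong (λ k → drop k (θ u)) (begin
  length (θ u) ∸ K           ≡⟨ cong (_∸ K) (length-θ-A m u |u|) ⟩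
  (K + 1) ∸ K                ≡⟨ m+n∸m≡n K 1 ⟩
  1                          ∎)
  where
    K : ℕ
    K = 2 ^ suc m + 1
    open ≡-Reasoning

-- The ε-part for words of 𝒜_m with a common first letter a: both images
-- start with (not a) and continue with the θ-images of the tails.
ε-mono : (m : ℕ) (u v : List Bool) → length u ≡ 2 ^ m + 1 → length v ≡ 2 ^ m + 1 →
  u <lex v → ∀ {a : Bool} {u′ v′ : List Bool} → u ≡ a ∷ u′ → v ≡ a ∷ v′ → ε m u <lex ε m v
ε-mono m u v |u| |v| (there u′<v′) refl refl
  rewrite ε-drop-first m u |u| | ε-drop-first m v |v| = there (θ-mono u′<v′)

lemma2 : (m : ℕ) → 2 ≤ m → (u v : List Bool) → InA m u → InA m v → u <lex v →
    (δ m u <lex δ m v) × (∀ {a : Bool} {u′ v′ : List Bool} → u ≡ a ∷ u′ → v ≡ a ∷ v′ → ε m u <lex ε m v)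
lemma2 m _ u v (_ , |u|) (_ , |v|) u<v =
  -- δ u is θ u without its last letter.
  θ-take-mono u<v (2 ^ suc m + 1) (≤-reflexive (trans (length-θ-A m u |u|) (+-comm _ 1))) ,
  ε-mono m u v |u| |v| u<v
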